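{- Let $G$ be a connected graph. A surjective edge coloring $\delta:E_G\to\{\text{red},\text{blue}\}$ is a Cartesian NAC-coloring if and only if for each induced non-monochromatic cycle of $G$, the colors change at least three times while passing around the cycle.
   Context: Graphs are simple, undirected, possibly countably infinite. A NAC-coloring of $G$ is a surjective map $\delta:E_G\to\{\text{red},\text{blue}\}$ such that for every cycle in $G$, either all its edges have the same color, or there are at least two edges of each color. A NAC-coloring is Cartesian if no two distinct vertices are connected simultaneously by a path all of whose edges are red and by a path all of whose edges are blue. The number of color changes along a cycle $(v_1,\dots,v_k,v_1)$ is the number of pairs of cyclically consecutive edges of the cycle having different colors. -}

module Defs where

open import Data.Nat using (ℕ; zero; suc; _+_; _≤_)
open import Data.Fin using (Fin; zero; suc)
open import Data.Bool using (Bool; true; false)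
open import Data.Product using (Σ; _×_; ∃)
open import Data.Sum using (_⊎_)
open import Data.Empty using (⊥)
open import Relation.Nullary using (¬_; yes; no)
open import Relation.Binary.PropositionalEquality using (_≡_; _≢_)
open import Function.Definitions using (Injective)
open import Function.Bundles using (_⇔_)

data Color : Set where
  red blue : Color

_≟C_ : (a b : Color) → Relation.Nullary.Dec (a ≡ b)
red  ≟C red  = yes _≡_.refl
red  ≟C blue = no (λ ())
blue ≟C red  = no (λ ())
blue ≟C blue = yes _≡_.refl

record Graph : Set₁ where
  field
    V         : Set
    adj       : V → V → Bool
    adj-sym   : ∀ u v → adj u v ≡ adj v u
    adj-irr   : ∀ v → adj v v ≡ false
    countable : Σ (V → ℕ) (Injective _≡_ _≡_)
open Graph public

data Walk {V : Set} (P : V → V → Set) : V → V → Set where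
  here  : ∀ {u} → Walk P u u
  step  : ∀ {u w v} → P u w → Walk P w v → Walk P u v

Edge : (G : Graph) → V G → V G → Set
Edge G u v = adj G u v ≡ true

Connected : Graph → Set
Connected G = ∀ (u v : V G) → Walk (Edge G) u v

-- An edge colouring: a colour for each unordered pair (only values on edges matter).
record Coloring (G : Graph) : Set where
  field
    col     : V G → V G → Color
    col-sym : ∀ u v → col u v ≡ col v u
open Coloring public

Surjective : (G : Graph) → Coloring G → Set
Surjective G δ = ∀ (c : Color) → ∃ λ u → ∃ λ v → Edge G u v × col δ u v ≡ c

-- cyclic successor on Fin (suc m)
next : ∀ {m} → Fin (suc m) → Fin (suc m)
next {zero}  zero    = zero
next {suc m} zero    = suc zero
next {suc m} (suc i) = lift (next {m} i)
  where
  lift : Fin (suc m) → Fin (suc (suc m))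
  lift zero    = zero
  lift (suc j) = suc (suc j)

count : ∀ {k} → (Fin k → Bool) → ℕ
count {zero}  p = 0
count {suc k} p with p zero
... | true  = suc (count (λ i → p (suc i)))
... | false = count (λ i → p (suc i))

record Cycle (G : Graph) : Set where
  field
    n     : ℕ
    vert  : Fin (3 + n) → V G
    inj   : Injective _≡_ _≡_ vert
    edges : ∀ i → Edge G (vert i) (vert (next i))
open Cycle public

Induced : {G : Graph} → Cycle G → Set
Induced {G} C = ∀ i j → Edge G (vert C i) (vert C j) → (j ≡ next i) ⊎ (i ≡ next j)

edgeCol : {G : Graph} → Coloring G → (C : Cycle G) → Fin (3 + n C) → Color
edgeCol δ C i = col δ (vert C i) (vert C (next i))

Monochromatic : {G : Graph} → Coloring G → Cycle G → Set
Monochromatic δ C = ∃ λ c → ∀ i → edgeCol δ C i ≡ c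

isCol : Color → Color → Bool
isCol a b with a ≟C b
... | yes _ = true
... | no  _ = false

numCol : {G : Graph} → Coloring G → (C : Cycle G) → Color → ℕ
numCol δ C c = count (λ i → isCol c (edgeCol δ C i))

colorChanges : {G : Graph} → Coloring G → Cycle G → ℕ
colorChanges δ C = count (λ i → Data.Bool.not (isCol (edgeCol δ C i) (edgeCol δ C (next i))))

IsNAC : (G : Graph) → Coloring G → Set
IsNAC G δ = Surjective G δ ×
  (∀ (C : Cycle G) → Monochromatic δ C ⊎ (2 ≤ numCol δ C red × 2 ≤ numCol δ C blue))

MonoEdge : (G : Graph) → Coloring G → Color → V G → V G → Set
MonoEdge G δ c u v = Edge G u v × col δ u v ≡ c

IsCartesianNAC : (G : Graph) → Coloring G → Set
IsCartesianNAC G δ = IsNAC G δ ×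
  (∀ (u v : V G) → u ≢ v → ¬ (Walk (MonoEdge G δ red) u v × Walk (MonoEdge G δ blue) u v))

{-# OPTIONS --safe #-}
module Submission where

-- Call a closed walk whose edges form an arc of one colour followed by an arc of the other
-- colour, with distinct end vertices of the arcs, a two-arc circuit; it is the same thing as a
-- red and a blue walk between two distinct vertices, i.e. a violation of the Cartesian
-- condition. Rotating a cycle that has exactly one edge of some colour, or exactly two colour
-- changes, gives a two-arc circuit, so without two-arc circuits both the NAC condition and
-- the bound of three colour changes hold. Conversely, a two-arc circuit of minimal length has
-- no repeated vertex and no chord: either would cut out a shorter two-arc circuit (possibly
-- after reversing the walk, which swaps the roles of the two arcs). So it is an induced
-- non-monochromatic cycle with only two colour changes.

open import Data.Bool using (Bool; true; false; not; if_then_else_)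
import Data.Bool.Properties as Bool
open import Data.Empty using (⊥; ⊥-elim)
open import Data.Fin using (Fin; zero; suc; toℕ; fromℕ; fromℕ<)
open import Data.Fin.Properties using (toℕ-injective; toℕ<n; toℕ-fromℕ<)
import Data.Fin.Properties as Fin
open import Data.Nat
  using (ℕ; zero; suc; pred; _+_; _∸_; _≤_; _<_; z≤n; s≤s; z<s; _≤?_; _<?_; _≟_; >-nonZero)
open import Data.Nat.Induction using (<-wellFounded)
open import Data.Nat.Properties
open import Data.Product using (Σ; _×_; ∃; _,_; proj₁; proj₂)
open import Data.Sum using (_⊎_; inj₁; inj₂)
import Data.Sum
open import Function.Base using (_∘_)
open import Function.Bundles using (mk↣; _⇔_; mk⇔)
open import Function.Definitions using (Injective)
open import Induction.WellFounded using (module All)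
open import Level using (0ℓ)
import Relation.Binary.Construct.On as On
open import Relation.Binary.Definitions using (DecidableEquality; tri<; tri≈; tri>)
open import Relation.Binary.PropositionalEquality
open import Relation.Nullary using (¬_; ¬?; Dec; yes; no; does)
open import Relation.Nullary.Decidable using (_×-dec_; _⊎-dec_; decidable-stable)

open import Defs

∸-suc : ∀ {m n} → n < m → m ∸ n ≡ suc (m ∸ suc n)
∸-suc {m} {n} = +-∸-assoc 1 {m} {suc n}

≤∸-suc : ∀ {m n o} → o ≤ m → n < m ∸ o → o ≤ m ∸ suc n
≤∸-suc {m} {n} {o} o≤m n<m∸o =
  m+n≤o⇒m≤o∸n o (subst (_≤ m) (+-comm (suc n) o) (m≤o∸n⇒m+n≤o (suc n) o≤m n<m∸o))

∸-suc-< : ∀ {m n o} → 0 < o → o ≤ m → m ∸ o ≤ n → m ∸ suc n < o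
∸-suc-< {m} {n} {o} 0<o o≤m m∸o≤n = m<n+o⇒m∸n<o m (suc n) {{>-nonZero 0<o}} (begin-strict
  m            ≡⟨ m∸n+n≡m o≤m ⟨
  m ∸ o + o    ≤⟨ +-monoˡ-≤ o m∸o≤n ⟩
  n + o        <⟨ n<1+n (n + o) ⟩
  suc n + o    ∎)
  where open ≤-Reasoning

2+m≤m+n⇒2≤n : ∀ m n → suc (suc m) ≤ m + n → 2 ≤ n
2+m≤m+n⇒2≤n m n = +-cancelˡ-≤ m 2 n ∘ subst (_≤ m + n) (+-comm 2 m)

constant-on : ∀ {A : Set} (f : ℕ → A) {i j} → (∀ t → i ≤ t → t < j → f t ≡ f (suc t)) →
              ∀ t → i ≤ t → t ≤ j → f t ≡ f i
constant-on f         same zero    z≤n   _   = refl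
constant-on f {i} {j} same (suc t) i≤1+t t<j with m≤n⇒m<n∨m≡n i≤1+t
... | inj₁ i<1+t = trans (sym (same t (≤-pred i<1+t) t<j)) (constant-on f same t (≤-pred i<1+t) (<⇒≤ t<j))
... | inj₂ refl = refl

other : Color → Color
other red  = blue
other blue = red

≢other : ∀ c → c ≢ other c
≢other red  ()
≢other blue ()

≢∧≢⇒≡ : ∀ {a b c : Color} → a ≢ b → c ≢ a → c ≡ b
≢∧≢⇒≡ {red}  {red}  a≢b _ = ⊥-elim (a≢b refl)
≢∧≢⇒≡ {blue} {blue} a≢b _ = ⊥-elim (a≢b refl)
≢∧≢⇒≡ {red}  {blue} {red}  _ c≢a = ⊥-elim (c≢a refl)
≢∧≢⇒≡ {red}  {blue} {blue} _ _   = refl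
≢∧≢⇒≡ {blue} {red}  {red}  _ _   = refl
≢∧≢⇒≡ {blue} {red}  {blue} _ c≢a = ⊥-elim (c≢a refl)

isCol-≡ : ∀ {a b} → a ≡ b → isCol a b ≡ true
isCol-≡ {a} refl with a ≟C a
... | yes _   = refl
... | no a≢a = ⊥-elim (a≢a refl)

isCol-≢ : ∀ {a b} → a ≢ b → isCol a b ≡ false
isCol-≢ {a} {b} a≢b with a ≟C b
... | yes a≡b = ⊥-elim (a≢b a≡b)
... | no _    = refl

-- Counting

module _ {k : ℕ} where

  remove : Fin k → (Fin k → Bool) → Fin k → Bool
  remove x p i = if does (i Fin.≟ x) then false else p i

  remove-≢ : ∀ {x y} (p : Fin k → Bool) → y ≢ x → remove x p y ≡ p y
  remove-≢ {x} {y} p y≢x with y Fin.≟ x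
  ... | yes y≡x = ⊥-elim (y≢x y≡x)
  ... | no _    = refl

count-cong : ∀ {k} (p q : Fin k → Bool) → (∀ i → p i ≡ q i) → count p ≡ count q
count-cong {zero}  _ _ _   = refl
count-cong {suc k} p q p≗q with p zero | q zero | p≗q zero
... | true  | true  | refl = cong suc (count-cong _ _ (λ i → p≗q (suc i)))
... | false | false | refl = count-cong _ _ (λ i → p≗q (suc i))

count-remove : ∀ {k} {x : Fin k} (p : Fin k → Bool) → p x ≡ true →
               count p ≡ suc (count (remove x p))
count-remove {x = zero}  p px with p zero
... | true = cong suc (count-cong (λ i → p (suc i)) _ (λ _ → refl))
count-remove {x = suc x} p px with p zero
... | true  = cong suc (count-remove (λ i → p (suc i)) px)
... | false = count-remove (λ i → p (suc i)) px

count-remove-≤ : ∀ {k} (x : Fin k) (p : Fin k → Bool) → count p ≤ suc (count (remove x p))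
count-remove-≤ zero p with p zero
... | true  = s≤s (≤-reflexive (count-cong (λ i → p (suc i)) _ (λ _ → refl)))
... | false = n≤1+n _
count-remove-≤ (suc x) p with p zero
... | true  = s≤s (count-remove-≤ x (λ i → p (suc i)))
... | false = count-remove-≤ x (λ i → p (suc i))

count-none : ∀ {k} (p : Fin k → Bool) → (∀ i → p i ≡ false) → count p ≡ 0
count-none {zero}  p _    = refl
count-none {suc k} p none with p zero | none zero
... | false | refl = count-none (λ i → p (suc i)) (λ i → none (suc i))

count≥1 : ∀ {k} {x : Fin k} (p : Fin k → Bool) → p x ≡ true → 1 ≤ count p
count≥1 p px rewrite count-remove p px = s≤s z≤n

count≥2 : ∀ {k} {x y : Fin k} (p : Fin k → Bool) → y ≢ x →
          p x ≡ true → p y ≡ true → 2 ≤ count p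
count≥2 p y≢x px py rewrite count-remove p px =
  s≤s (count≥1 (remove _ p) (trans (remove-≢ p y≢x) py))

count≥3 : ∀ {k} {x y z : Fin k} (p : Fin k → Bool) → y ≢ x → z ≢ x → z ≢ y →
          p x ≡ true → p y ≡ true → p z ≡ true → 3 ≤ count p
count≥3 p y≢x z≢x z≢y px py pz rewrite count-remove p px =
  s≤s (count≥2 (remove _ p) z≢y (trans (remove-≢ p y≢x) py) (trans (remove-≢ p z≢x) pz))

count≤2 : ∀ {k} (x y : Fin k) (p : Fin k → Bool) →
          (∀ i → p i ≡ true → i ≡ x ⊎ i ≡ y) → count p ≤ 2
count≤2 x y p only =
  ≤-trans (count-remove-≤ x p)
    (s≤s (≤-trans (count-remove-≤ y (remove x p))
      (s≤s (≤-reflexive (count-none (remove y (remove x p)) removed)))))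
  where
  removed : ∀ i → remove y (remove x p) i ≡ false
  removed i with i Fin.≟ y | i Fin.≟ x | p i in pi
  ... | yes _ | _     | _     = refl
  ... | no _  | yes _ | _     = refl
  ... | no _  | no _  | false = refl
  ... | no i≢y | no i≢x | true with only i pi
  ...   | inj₁ i≡x = ⊥-elim (i≢x i≡x)
  ...   | inj₂ i≡y = ⊥-elim (i≢y i≡y)

-- The cyclic successor

toℕ-next : ∀ {m} (i : Fin (suc m)) →
           (toℕ i < m × toℕ (next i) ≡ suc (toℕ i)) ⊎ (toℕ i ≡ m × next i ≡ zero)
toℕ-next {zero}  zero    = inj₂ (refl , refl)
toℕ-next {suc m} zero    = inj₁ (s≤s z≤n , refl)
toℕ-next {suc m} (suc i) with next {m} i | toℕ-next {m} i
... | zero  | inj₂ (i≡m , _)     = inj₂ (cong suc i≡m , refl)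
... | suc j | inj₁ (i<m , next≡) = inj₁ (s≤s i<m , cong suc next≡)

module Advance (M : ℕ) where

  advance : Fin (suc M) → ℕ → Fin (suc M)
  advance i zero    = i
  advance i (suc d) = next (advance i d)

  advance-+ : ∀ i a b → advance i (a + b) ≡ advance (advance i a) b
  advance-+ i a zero    = cong (advance i) (+-identityʳ a)
  advance-+ i a (suc b) = trans (cong (advance i) (+-suc a b)) (cong next (advance-+ i a b))

  toℕ-advance : ∀ i d → toℕ i + d ≤ M → toℕ (advance i d) ≡ toℕ i + d
  toℕ-advance i zero    _ = sym (+-identityʳ _)
  toℕ-advance i (suc d) i+d<M with toℕ-next (advance i d)
  ... | inj₁ (_ , next≡) = begin
    toℕ (next (advance i d))  ≡⟨ next≡ ⟩
    suc (toℕ (advance i d))   ≡⟨ cong suc (toℕ-advance i d i+d≤M) ⟩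
    suc (toℕ i + d)           ≡⟨ +-suc (toℕ i) d ⟨
    toℕ i + suc d             ∎
    where
    open ≡-Reasoning
    i+d≤M = ≤-trans (+-monoʳ-≤ (toℕ i) (n≤1+n d)) i+d<M
  ... | inj₂ (at-M , _) = ⊥-elim (<-irrefl at-M (begin-strict
    toℕ (advance i d)  ≡⟨ toℕ-advance i d (≤-trans (+-monoʳ-≤ (toℕ i) (n≤1+n d)) i+d<M) ⟩
    toℕ i + d          <⟨ m<m+n _ z<s ⟩
    toℕ i + d + 1      ≡⟨ +-assoc (toℕ i) d 1 ⟩
    toℕ i + (d + 1)    ≡⟨ cong (toℕ i +_) (+-comm d 1) ⟩
    toℕ i + suc d      ≤⟨ i+d<M ⟩
    M                  ∎))
    where open ≤-Reasoning

  advance-from-zero : ∀ j → advance zero (toℕ j) ≡ j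
  advance-from-zero j = toℕ-injective (toℕ-advance zero (toℕ j) (≤-pred (toℕ<n j)))

  advance-to-zero : ∀ i → advance i (suc (M ∸ toℕ i)) ≡ zero
  advance-to-zero i with toℕ-next (advance i (M ∸ toℕ i))
  ... | inj₂ (_ , next≡0) = next≡0
  ... | inj₁ (below-M , _) = ⊥-elim (<-irrefl at-M below-M)
    where
    i≤M = ≤-pred (toℕ<n i)
    at-M : toℕ (advance i (M ∸ toℕ i)) ≡ M
    at-M = trans (toℕ-advance i (M ∸ toℕ i) (≤-reflexive (m+[n∸m]≡n i≤M))) (m+[n∸m]≡n i≤M)

  advance-period : ∀ i → advance i (suc M) ≡ i
  advance-period i = begin
    advance i (suc M)                              ≡⟨ cong (advance i) M+1≡ ⟨
    advance i (suc (M ∸ toℕ i) + toℕ i)            ≡⟨ advance-+ i (suc (M ∸ toℕ i)) (toℕ i) ⟩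
    advance (advance i (suc (M ∸ toℕ i))) (toℕ i)  ≡⟨ cong (λ j → advance j (toℕ i)) (advance-to-zero i) ⟩
    advance zero (toℕ i)                           ≡⟨ advance-from-zero i ⟩
    i                                              ∎
    where
    open ≡-Reasoning
    M+1≡ : suc (M ∸ toℕ i) + toℕ i ≡ suc M
    M+1≡ = cong suc (m∸n+n≡m (≤-pred (toℕ<n i)))

  advance-next-M : ∀ i → advance (next i) M ≡ i
  advance-next-M i = trans (sym (advance-+ i 1 M)) (advance-period i)

  advance-via-zero : ∀ i d → advance i d ≡ advance zero (toℕ i + d)
  advance-via-zero i d = begin
    advance i d                         ≡⟨ cong (λ j → advance j d) (advance-from-zero i) ⟨
    advance (advance zero (toℕ i)) d    ≡⟨ advance-+ zero (toℕ i) d ⟨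
    advance zero (toℕ i + d)            ∎
    where open ≡-Reasoning

  advance-≢ : ∀ i d → 0 < d → d ≤ M → advance i d ≢ i
  advance-≢ i d 0<d d≤M i+d≡i with toℕ i + d ≤? M
  ... | yes fits = <-irrefl (trans (cong toℕ (sym i+d≡i)) (toℕ-advance i d fits)) (m<m+n (toℕ i) 0<d)
  ... | no overflow = <-irrefl r≡x r<x
    where
    x = toℕ i
    wrap = m≤n⇒∃[o]m+o≡n (≰⇒> overflow)
    r = proj₁ wrap
    r<x : r < x
    r<x = +-cancelˡ-≤ M (suc r) x (begin
      M + suc r    ≡⟨ +-suc M r ⟩
      suc M + r    ≡⟨ proj₂ wrap ⟩
      x + d        ≤⟨ +-monoʳ-≤ x d≤M ⟩
      x + M        ≡⟨ +-comm x M ⟩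
      M + x        ∎)
      where open ≤-Reasoning
    r≡x : r ≡ x
    r≡x = begin
      r                                       ≡⟨ toℕ-advance zero r r≤M ⟨
      toℕ (advance zero r)                    ≡⟨ cong (λ j → toℕ (advance j r)) (advance-period zero) ⟨
      toℕ (advance (advance zero (suc M)) r)  ≡⟨ cong toℕ (advance-+ zero (suc M) r) ⟨
      toℕ (advance zero (suc M + r))          ≡⟨ cong (λ n → toℕ (advance zero n)) (proj₂ wrap) ⟩
      toℕ (advance zero (x + d))              ≡⟨ cong toℕ (advance-via-zero i d) ⟨
      toℕ (advance i d)                       ≡⟨ cong toℕ i+d≡i ⟩
      x                                       ∎
      where
      open ≡-Reasoning
      r≤M = <⇒≤ (<-≤-trans r<x (≤-pred (toℕ<n i)))

  advance-window : ∀ i {a b} → a < b → b ≤ M → advance i a ≢ advance i b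
  advance-window i {a} {b} a<b b≤M eq =
    advance-≢ (advance i a) (b ∸ a) (m<n⇒0<n∸m a<b) (≤-trans (m∸n≤m b a) b≤M) (begin
      advance (advance i a) (b ∸ a)  ≡⟨ advance-+ i a (b ∸ a) ⟨
      advance i (a + (b ∸ a))        ≡⟨ cong (advance i) (m+[n∸m]≡n (<⇒≤ a<b)) ⟩
      advance i b                    ≡⟨ eq ⟨
      advance i a                    ∎)
    where open ≡-Reasoning

  advance-injective : ∀ i {a b} → a ≢ b → a ≤ M → b ≤ M → advance i a ≢ advance i b
  advance-injective i {a} {b} a≢b a≤M b≤M with <-cmp a b
  ... | tri< a<b _ _ = advance-window i a<b b≤M
  ... | tri≈ _ a≡b _ = ⊥-elim (a≢b a≡b)
  ... | tri> _ _ b<a = λ eq → advance-window i b<a a≤M (sym eq)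

-- Walks

module _ {X : Set} {P : X → X → Set} where

  snoc : ∀ {u v x} → Walk P u v → P v x → Walk P u x
  snoc here       p = step p here
  snoc (step q W) p = step q (snoc W p)

  reverse : (∀ {x y} → P x y → P y x) → ∀ {u v} → Walk P u v → Walk P v u
  reverse sym-P here       = here
  reverse sym-P (step p W) = snoc (reverse sym-P W) (sym-P p)

  walkLength : ∀ {u v} → Walk P u v → ℕ
  walkLength here       = 0
  walkLength (step _ W) = suc (walkLength W)

  vertexAt : ∀ {u v} → Walk P u v → ℕ → X
  vertexAt {u} here       _       = u
  vertexAt {u} (step _ W) zero    = u
  vertexAt     (step _ W) (suc t) = vertexAt W t

  vertexAt-0 : ∀ {u v} (W : Walk P u v) → vertexAt W 0 ≡ u
  vertexAt-0 here       = refl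
  vertexAt-0 (step _ _) = refl

  vertexAt-end : ∀ {u v} (W : Walk P u v) → vertexAt W (walkLength W) ≡ v
  vertexAt-end here       = refl
  vertexAt-end (step _ W) = vertexAt-end W

  vertexAt-step : ∀ {u v} (W : Walk P u v) → ∀ t → t < walkLength W →
                  P (vertexAt W t) (vertexAt W (suc t))
  vertexAt-step {u} (step p W) zero    _         = subst (P u) (sym (vertexAt-0 W)) p
  vertexAt-step     (step p W) (suc t) (s≤s t<n) = vertexAt-step W t t<n

  walkLength-≢ : ∀ {u v} (W : Walk P u v) → u ≢ v → 0 < walkLength W
  walkLength-≢ here       u≢u = ⊥-elim (u≢u refl)
  walkLength-≢ (step _ _) _   = s≤s z≤n

  walkAlong : (w : ℕ → X) → ∀ i d → (∀ t → i ≤ t → t < i + d → P (w t) (w (suc t))) →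
              Walk P (w i) (w (i + d))
  walkAlong w i zero    _    = subst (λ j → Walk P (w i) (w j)) (sym (+-identityʳ i)) here
  walkAlong w i (suc d) path = step (path i ≤-refl (m<m+n i z<s))
    (subst (λ j → Walk P (w (suc i)) (w j)) (sym (+-suc i d))
      (walkAlong w (suc i) d (λ t i<t t<i+d →
        path t (<⇒≤ i<t) (subst (t <_) (sym (+-suc i d)) t<i+d))))

module Colouring (G : Graph) (δ : Coloring G) where

  _≟V_ : DecidableEquality (V G)
  _≟V_ = eq? (mk↣ (proj₂ (countable G)))

  edge-irrefl : ∀ {u v} → Edge G u v → u ≢ v
  edge-irrefl {u} uu refl with trans (sym (adj-irr G u)) uu
  ... | ()

  edge-sym : ∀ {u v} → Edge G u v → Edge G v u
  edge-sym {u} {v} = trans (adj-sym G v u)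

  monoEdge-sym : ∀ {c u v} → MonoEdge G δ c u v → MonoEdge G δ c v u
  monoEdge-sym {u = u} {v} (uv , c) = edge-sym uv , trans (col-sym δ v u) c

  Cartesian : Set
  Cartesian = ∀ u v → u ≢ v → ¬ (Walk (MonoEdge G δ red) u v × Walk (MonoEdge G δ blue) u v)

  record TwoArcCircuit : Set where
    field
      a b        : Color
      a≢b        : a ≢ b
      L k        : ℕ
      w          : ℕ → V G
      0<k        : 0 < k
      k<L        : k < L
      closed     : w 0 ≡ w L
      w₀≢wₖ      : w 0 ≢ w k
      edge       : ∀ t → t < L → Edge G (w t) (w (suc t))
      first-arc  : ∀ t → t < k → col δ (w t) (w (suc t)) ≡ a
      second-arc : ∀ t → k ≤ t → t < L → col δ (w t) (w (suc t)) ≡ b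

  cartesian⇒noCircuit : Cartesian → ¬ TwoArcCircuit
  cartesian⇒noCircuit cartesian C = bichromatic a b a≢b first-walk second-walk
    where
    open TwoArcCircuit C
    first-walk : Walk (MonoEdge G δ a) (w 0) (w k)
    first-walk = walkAlong w 0 k (λ t _ t<k → edge t (<-trans t<k k<L) , first-arc t t<k)
    k+[L∸k]≡L = m+[n∸m]≡n (<⇒≤ k<L)
    second-walk : Walk (MonoEdge G δ b) (w 0) (w k)
    second-walk = subst (λ u → Walk _ u (w k)) (sym closed)
      (reverse monoEdge-sym (subst (λ j → Walk _ (w k) (w j)) k+[L∸k]≡L
        (walkAlong w k (L ∸ k) (λ t k≤t t<L →
          let t<L = subst (t <_) k+[L∸k]≡L t<L in edge t t<L , second-arc t k≤t t<L))))
    bichromatic : ∀ a b → a ≢ b → Walk (MonoEdge G δ a) (w 0) (w k) →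
                  Walk (MonoEdge G δ b) (w 0) (w k) → ⊥
    bichromatic red  red  a≢b _ _ = a≢b refl
    bichromatic blue blue a≢b _ _ = a≢b refl
    bichromatic red  blue _   P Q = cartesian _ _ w₀≢wₖ (P , Q)
    bichromatic blue red  _   P Q = cartesian _ _ w₀≢wₖ (Q , P)

  walks⇒circuit : ∀ {u v} → u ≢ v → Walk (MonoEdge G δ red) u v → Walk (MonoEdge G δ blue) u v →
                  TwoArcCircuit
  walks⇒circuit {u} {v} u≢v P Q = record
    { a = red ; b = blue ; a≢b = λ () ; L = L ; k = k ; w = w
    ; 0<k = walkLength-≢ P u≢v ; k<L = k<L
    ; closed = begin
        w 0                ≡⟨ along-P 0 z≤n ⟩
        vertexAt P 0       ≡⟨ vertexAt-0 P ⟩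
        u                  ≡⟨ vertexAt-0 Q ⟨
        vertexAt Q 0       ≡⟨ cong (vertexAt Q) (n∸n≡0 L) ⟨
        vertexAt Q (L ∸ L) ≡⟨ along-Q L (<⇒≤ k<L) ⟨
        w L                ∎
    ; w₀≢wₖ = λ w₀≡wₖ → u≢v (begin
        u             ≡⟨ vertexAt-0 P ⟨
        vertexAt P 0  ≡⟨ along-P 0 z≤n ⟨
        w 0           ≡⟨ w₀≡wₖ ⟩
        w k           ≡⟨ along-P k ≤-refl ⟩
        vertexAt P k  ≡⟨ vertexAt-end P ⟩
        v             ∎)
    ; edge = edge
    ; first-arc = λ t t<k → proj₂ (red-step t t<k)
    ; second-arc = λ t k≤t t<L → proj₂ (blue-step t k≤t t<L) }
    where
    open ≡-Reasoning
    k = walkLength P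
    L = k + walkLength Q
    k<L : k < L
    k<L = m<m+n k (walkLength-≢ Q u≢v)
    w : ℕ → V G
    w t with t ≤? k
    ... | yes _ = vertexAt P t
    ... | no _  = vertexAt Q (L ∸ t)
    along-P : ∀ t → t ≤ k → w t ≡ vertexAt P t
    along-P t t≤k with t ≤? k
    ... | yes _   = refl
    ... | no t≰k = ⊥-elim (t≰k t≤k)
    along-Q : ∀ t → k ≤ t → w t ≡ vertexAt Q (L ∸ t)
    along-Q t k≤t with t ≤? k
    ... | no _    = refl
    ... | yes t≤k with ≤-antisym t≤k k≤t
    ...   | refl = begin
      vertexAt P k                   ≡⟨ vertexAt-end P ⟩
      v                              ≡⟨ vertexAt-end Q ⟨
      vertexAt Q (walkLength Q)      ≡⟨ cong (vertexAt Q) (m+n∸m≡n k (walkLength Q)) ⟨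
      vertexAt Q (L ∸ k)             ∎
    red-step : ∀ t → t < k → MonoEdge G δ red (w t) (w (suc t))
    red-step t t<k = subst₂ (MonoEdge G δ red) (sym (along-P t (<⇒≤ t<k))) (sym (along-P (suc t) t<k))
      (vertexAt-step P t t<k)
    blue-step : ∀ t → k ≤ t → t < L → MonoEdge G δ blue (w t) (w (suc t))
    blue-step t k≤t t<L = subst₂ (MonoEdge G δ blue)
      (sym (trans (along-Q t k≤t) (cong (vertexAt Q) (∸-suc t<L))))
      (sym (along-Q (suc t) (m≤n⇒m≤1+n k≤t)))
      (monoEdge-sym (vertexAt-step Q (L ∸ suc t) in-Q))
      where
      in-Q : L ∸ suc t < walkLength Q
      in-Q = subst (L ∸ suc t <_) (m+n∸m≡n k (walkLength Q))
        (∸-monoʳ-< (s≤s k≤t) t<L)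
    edge : ∀ t → t < L → Edge G (w t) (w (suc t))
    edge t t<L with <-≤-connex t k
    ... | inj₁ t<k = proj₁ (red-step t t<k)
    ... | inj₂ k≤t = proj₁ (blue-step t k≤t t<L)

  module OnCycle (C : Cycle G) where
    M : ℕ
    M = suc (suc (n C))
    open Advance M public

    colourFrom : Fin (suc M) → ℕ → Color
    colourFrom s t = edgeCol δ C (advance s t)

    changes : Fin (suc M) → Bool
    changes i = not (isCol (edgeCol δ C i) (edgeCol δ C (next i)))

    Change : Fin (suc M) → ℕ → Set
    Change s t = colourFrom s t ≢ colourFrom s (suc t)

    change? : ∀ s t → Dec (Change s t)
    change? s t = ¬? (colourFrom s t ≟C colourFrom s (suc t))

    change⇒counted : ∀ s t → Change s t → changes (advance s t) ≡ true
    change⇒counted s t ch = cong not (isCol-≢ ch)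

    no-change⇒constant : ∀ s {i j} → (∀ t → i ≤ t → t < j → ¬ Change s t) →
                         ∀ t → i ≤ t → t ≤ j → colourFrom s t ≡ colourFrom s i
    no-change⇒constant s none = constant-on (colourFrom s) (λ t i≤t t<j →
      decidable-stable (colourFrom s t ≟C colourFrom s (suc t)) (none t i≤t t<j))

    rotatedCircuit : ∀ s {a b} → a ≢ b → ∀ k → 0 < k → k ≤ M →
                     (∀ t → t < k → colourFrom s t ≡ a) →
                     (∀ t → k ≤ t → t ≤ M → colourFrom s t ≡ b) → TwoArcCircuit
    rotatedCircuit s {a} {b} a≢b k 0<k k≤M first second = record
      { a = a ; b = b ; a≢b = a≢b ; L = suc M ; k = k ; w = λ t → vert C (advance s t)
      ; 0<k = 0<k ; k<L = s≤s k≤M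
      ; closed = cong (vert C) (sym (advance-period s))
      ; w₀≢wₖ = λ eq → advance-injective s (<⇒≢ 0<k) z≤n k≤M (inj C eq)
      ; edge = λ t _ → edges C (advance s t)
      ; first-arc = first
      ; second-arc = λ t k≤t t<L → second t k≤t (≤-pred t<L) }

    -- Any change besides the one at M and a first change t₁ before M gives three changes; if
    -- there is none, the edges read from s form two monochromatic arcs.
    three-changes-from : ¬ TwoArcCircuit → ∀ s → Change s M → 3 ≤ colorChanges δ C
    three-changes-from noCircuit s last with anyUpTo? (change? s) M
    ... | no none = ⊥-elim (last (begin
      colourFrom s M        ≡⟨ no-change⇒constant s (λ t _ t<M ch → none (t , t<M , ch)) M z≤n ≤-refl ⟩
      colourFrom s 0        ≡⟨ cong (edgeCol δ C) (advance-period s) ⟨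
      colourFrom s (suc M)  ∎))
      where open ≡-Reasoning
    ... | yes (t₁ , t₁<M , ch₁) with anyUpTo? (λ t → ¬? (t ≟ t₁) ×-dec change? s t) M
    ...   | yes (t₂ , t₂<M , t₂≢t₁ , ch₂) =
      count≥3 changes
        (advance-injective s t₂≢t₁ (<⇒≤ t₂<M) (<⇒≤ t₁<M))
        (advance-injective s (≢-sym (<⇒≢ t₁<M)) ≤-refl (<⇒≤ t₁<M))
        (advance-injective s (≢-sym (<⇒≢ t₂<M)) ≤-refl (<⇒≤ t₂<M))
        (change⇒counted s t₁ ch₁) (change⇒counted s t₂ ch₂) (change⇒counted s M last)
    ...   | no only = ⊥-elim (noCircuit
      (rotatedCircuit s (λ eq → ch₁ (trans (first t₁ ≤-refl) eq)) (suc t₁) z<s t₁<M first second))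
      where
      first : ∀ t → t < suc t₁ → colourFrom s t ≡ colourFrom s 0
      first t t≤t₁ = no-change⇒constant s
        (λ t _ t<t₁ ch → only (t , <-trans t<t₁ t₁<M , <⇒≢ t<t₁ , ch)) t z≤n (≤-pred t≤t₁)
      second : ∀ t → suc t₁ ≤ t → t ≤ M → colourFrom s t ≡ colourFrom s (suc t₁)
      second = no-change⇒constant s (λ t t₁<t t<M ch → only (t , t<M , ≢-sym (<⇒≢ t₁<t) , ch))

  noCircuit⇒colorChanges≥3 : ¬ TwoArcCircuit → (C : Cycle G) → ¬ Monochromatic δ C →
                             3 ≤ colorChanges δ C
  noCircuit⇒colorChanges≥3 noCircuit C nonmono with Fin.any? (λ i → change? i 0)
    where open OnCycle C
  ... | no none = ⊥-elim (nonmono (edgeCol δ C zero , monochrome))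
    where
    open OnCycle C
    monochrome : ∀ j → edgeCol δ C j ≡ edgeCol δ C zero
    monochrome j = subst (λ i → edgeCol δ C i ≡ _) (advance-from-zero j)
      (no-change⇒constant zero (λ t _ _ ch → none (advance zero t , ch)) (toℕ j) z≤n (≤-pred (toℕ<n j)))
  ... | yes (i , change) = three-changes-from noCircuit (next i)
    (change ∘ subst₂ _≡_ (cong (edgeCol δ C) (advance-next-M i))
                         (cong (edgeCol δ C) (advance-period (next i))))
    where open OnCycle C

  noCircuit⇒monochromatic : ¬ TwoArcCircuit → (C : Cycle G) → ∀ c → ¬ (2 ≤ numCol δ C c) →
                            Monochromatic δ C
  noCircuit⇒monochromatic noCircuit C c few with Fin.any? (λ i → edgeCol δ C i ≟C c)
  ... | no none = other c , λ j → ≢∧≢⇒≡ (≢other c) (λ eq → none (j , eq))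
  ... | yes (i , iᶜ) = ⊥-elim (noCircuit
    (rotatedCircuit (next i) (≢-sym (≢other c)) M z<s ≤-refl first last))
    where
    open OnCycle C
    first : ∀ t → t < M → colourFrom (next i) t ≡ other c
    first t t<M = ≢∧≢⇒≡ (≢other c) λ tᶜ → few
      (count≥2 (λ j → isCol c (edgeCol δ C j))
        (λ eq → advance-injective i (λ ()) z≤n t<M (trans (sym eq) (sym (advance-+ i 1 t))))
        (isCol-≡ (sym iᶜ)) (isCol-≡ (sym tᶜ)))
    last : ∀ t → M ≤ t → t ≤ M → colourFrom (next i) t ≡ c
    last t M≤t t≤M rewrite ≤-antisym t≤M M≤t = trans (cong (edgeCol δ C) (advance-next-M i)) iᶜ

  noCircuit⇒NAC-cycle : ¬ TwoArcCircuit → (C : Cycle G) →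
                        Monochromatic δ C ⊎ (2 ≤ numCol δ C red × 2 ≤ numCol δ C blue)
  noCircuit⇒NAC-cycle noCircuit C with 2 ≤? numCol δ C red | 2 ≤? numCol δ C blue
  ... | yes 2≤red | yes 2≤blue = inj₂ (2≤red , 2≤blue)
  ... | no few    | _          = inj₁ (noCircuit⇒monochromatic noCircuit C red few)
  ... | yes _     | no few     = inj₁ (noCircuit⇒monochromatic noCircuit C blue few)

  -- Shortening a two-arc circuit

  Shorter : TwoArcCircuit → Set
  Shorter C = Σ TwoArcCircuit λ C′ → TwoArcCircuit.L C′ < TwoArcCircuit.L C

  reversed : TwoArcCircuit → TwoArcCircuit
  reversed C = record
    { a = b ; b = a ; a≢b = ≢-sym a≢b ; L = L ; k = L ∸ k ; w = λ t → w (L ∸ t)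
    ; 0<k = m<n⇒0<n∸m k<L
    ; k<L = ∸-monoʳ-< 0<k (<⇒≤ k<L)
    ; closed = trans (sym closed) (cong w (sym (n∸n≡0 L)))
    ; w₀≢wₖ = λ eq → w₀≢wₖ (trans closed (trans eq (cong w (m∸[m∸n]≡n (<⇒≤ k<L)))))
    ; edge = λ t t<L → subst (λ u → Edge G u (w (L ∸ suc t))) (sym (cong w (∸-suc t<L)))
                         (edge-sym (edge _ (mirror t<L)))
    ; first-arc = λ t t<L∸k → let t<L = <-≤-trans t<L∸k (m∸n≤m L k) in
        trans (reversed-colour t<L) (second-arc _ (≤∸-suc (<⇒≤ k<L) t<L∸k) (mirror t<L))
    ; second-arc = λ t L∸k≤t t<L →
        trans (reversed-colour t<L) (first-arc _ (∸-suc-< 0<k (<⇒≤ k<L) L∸k≤t)) }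
    where
    open TwoArcCircuit C
    mirror : ∀ {t} → t < L → L ∸ suc t < L
    mirror t<L = ∸-monoʳ-< z<s t<L
    reversed-colour : ∀ {t} → t < L →
      col δ (w (L ∸ t)) (w (L ∸ suc t)) ≡ col δ (w (L ∸ suc t)) (w (suc (L ∸ suc t)))
    reversed-colour t<L = trans (col-sym δ _ _) (cong (col δ _) (cong w (∸-suc t<L)))

  module Surgery (C : TwoArcCircuit) where
    open TwoArcCircuit C

    Fits : ℕ → ℕ → Color → Set
    Fits k′ t c = (t < k′ → c ≡ a) × (k′ ≤ t → c ≡ b)

    FittingEdge : ℕ → ℕ → V G → V G → Set
    FittingEdge k′ t u v = Edge G u v × Fits k′ t (col δ u v)

    SameArc : ℕ → ℕ → ℕ → Set
    SameArc k′ t s = (t < k′ → s < k) × (k′ ≤ t → k ≤ s)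

    old-edge : ∀ {k′ t s} → SameArc k′ t s → s < L → FittingEdge k′ t (w s) (w (suc s))
    old-edge (below , above) s<L =
      edge _ s<L , (λ t<k′ → first-arc _ (below t<k′)) , (λ k′≤t → second-arc _ (above k′≤t) s<L)

    reshaped : ∀ L′ k′ (w′ : ℕ → V G) → 0 < k′ → k′ < L′ →
               w′ 0 ≡ w′ L′ → w′ 0 ≢ w′ k′ →
               (∀ t → t < L′ → FittingEdge k′ t (w′ t) (w′ (suc t))) → TwoArcCircuit
    reshaped L′ k′ w′ 0<k′ k′<L′ closed′ w′₀≢w′ₖ fitting = record
      { a = a ; b = b ; a≢b = a≢b ; L = L′ ; k = k′ ; w = w′ ; 0<k = 0<k′ ; k<L = k′<L′
      ; closed = closed′ ; w₀≢wₖ = w′₀≢w′ₖ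
      ; edge = λ t t<L′ → proj₁ (fitting t t<L′)
      ; first-arc = λ t t<k′ → proj₁ (proj₂ (fitting t (<-trans t<k′ k′<L′))) t<k′
      ; second-arc = λ t k′≤t t<L′ → proj₂ (proj₂ (fitting t t<L′)) k′≤t }

    -- Replaces the e + 1 edges from w i to w (i + e + 1) by a single edge.
    shortcut : ∀ i e k′ → 0 < e → i + e < L →
               FittingEdge k′ i (w i) (w (suc (i + e))) →
               (∀ t → t < i → SameArc k′ t t) →
               (∀ t → i < t → t < L ∸ e → SameArc k′ t (t + e)) →
               0 < k′ → k′ < L ∸ e →
               (k′ ≤ i → w 0 ≢ w k′) → (i < k′ → w 0 ≢ w (k′ + e)) → Shorter C
    shortcut i e k′ 0<e i+e<L bridge before after 0<k′ k′<L′ ne-before ne-after =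
      reshaped L′ k′ w′ 0<k′ k′<L′ closed′ w′₀≢w′ₖ fitting , ∸-monoʳ-< 0<e e≤L
      where
      L′ = L ∸ e
      e≤L : e ≤ L
      e≤L = ≤-trans (m≤n+m e i) (<⇒≤ i+e<L)
      t<L′⇒t+e<L : ∀ {t} → t < L′ → t + e < L
      t<L′⇒t+e<L {t} t<L′ = subst (t + e <_) (m∸n+n≡m e≤L) (+-monoˡ-< e t<L′)
      w′ : ℕ → V G
      w′ t with t ≤? i
      ... | yes _ = w t
      ... | no _  = w (t + e)
      w′-before : ∀ t → t ≤ i → w′ t ≡ w t
      w′-before t t≤i with t ≤? i
      ... | yes _   = refl
      ... | no t≰i = ⊥-elim (t≰i t≤i)
      w′-after : ∀ t → i < t → w′ t ≡ w (t + e)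
      w′-after t i<t with t ≤? i
      ... | no _    = refl
      ... | yes t≤i = ⊥-elim (<⇒≱ i<t t≤i)
      i<L′ : i < L′
      i<L′ = subst (_< L′) (m+n∸n≡m i e) (∸-monoˡ-< i+e<L (m≤n+m e i))
      closed′ : w′ 0 ≡ w′ L′
      closed′ = begin
        w′ 0         ≡⟨ w′-before 0 z≤n ⟩
        w 0          ≡⟨ closed ⟩
        w L          ≡⟨ cong w (m∸n+n≡m e≤L) ⟨
        w (L′ + e)   ≡⟨ w′-after L′ i<L′ ⟨
        w′ L′        ∎
        where open ≡-Reasoning
      w′₀≢w′ₖ : w′ 0 ≢ w′ k′
      w′₀≢w′ₖ eq with ≤-<-connex k′ i
      ... | inj₁ k′≤i = ne-before k′≤i (trans (sym (w′-before 0 z≤n)) (trans eq (w′-before k′ k′≤i)))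
      ... | inj₂ i<k′ = ne-after i<k′  (trans (sym (w′-before 0 z≤n)) (trans eq (w′-after k′ i<k′)))
      fitting : ∀ t → t < L′ → FittingEdge k′ t (w′ t) (w′ (suc t))
      fitting t t<L′ with <-cmp t i
      ... | tri< t<i _ _ =
        subst₂ (FittingEdge k′ t) (sym (w′-before t (<⇒≤ t<i))) (sym (w′-before (suc t) t<i))
          (old-edge (before t t<i) (<-trans t<i (≤-<-trans (m≤m+n i e) i+e<L)))
      ... | tri≈ _ refl _ =
        subst₂ (FittingEdge k′ t) (sym (w′-before t ≤-refl)) (sym (w′-after (suc t) ≤-refl)) bridge
      ... | tri> _ _ i<t =
        subst₂ (FittingEdge k′ t) (sym (w′-after t i<t)) (sym (w′-after (suc t) (m≤n⇒m≤1+n i<t)))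
          (old-edge (after t i<t t<L′) (t<L′⇒t+e<L t<L′))

    -- The closed walk w i, …, w (i + d), w i, closed by an edge of colour b.
    window : ∀ i d k′ → i + d ≤ L → suc d < L →
             Edge G (w (i + d)) (w i) → col δ (w (i + d)) (w i) ≡ b →
             (∀ t → t < d → SameArc k′ t (i + t)) →
             0 < k′ → k′ ≤ d → w i ≢ w (i + k′) → Shorter C
    window i d k′ i+d≤L d<L closing closingᵇ inside 0<k′ k′≤d ne =
      reshaped (suc d) k′ w′ 0<k′ (s≤s k′≤d) closed′ w′₀≢w′ₖ fitting , d<L
      where
      w′ : ℕ → V G
      w′ t with t ≤? d
      ... | yes _ = w (i + t)
      ... | no _  = w i
      w′-inside : ∀ t → t ≤ d → w′ t ≡ w (i + t)
      w′-inside t t≤d with t ≤? d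
      ... | yes _   = refl
      ... | no t≰d = ⊥-elim (t≰d t≤d)
      w′-end : w′ (suc d) ≡ w i
      w′-end with suc d ≤? d
      ... | no _      = refl
      ... | yes 1+d≤d = ⊥-elim (<-irrefl refl 1+d≤d)
      w′-start : w′ 0 ≡ w i
      w′-start = trans (w′-inside 0 z≤n) (cong w (+-identityʳ i))
      closed′ : w′ 0 ≡ w′ (suc d)
      closed′ = trans w′-start (sym w′-end)
      w′₀≢w′ₖ : w′ 0 ≢ w′ k′
      w′₀≢w′ₖ eq = ne (trans (sym w′-start) (trans eq (w′-inside k′ k′≤d)))
      fitting : ∀ t → t < suc d → FittingEdge k′ t (w′ t) (w′ (suc t))
      fitting t t<1+d with m≤n⇒m<n∨m≡n (≤-pred t<1+d)
      ... | inj₁ t<d = subst₂ (FittingEdge k′ t) (sym (w′-inside t (<⇒≤ t<d)))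
                         (sym (trans (w′-inside (suc t) t<d) (cong w (+-suc i t))))
                         (old-edge (inside t t<d) (<-≤-trans (+-monoʳ-< i t<d) i+d≤L))
      ... | inj₂ refl = subst₂ (FittingEdge k′ t) (sym (w′-inside t ≤-refl)) (sym w′-end)
                         (closing , (λ t<k′ → ⊥-elim (<⇒≱ t<k′ k′≤d)) , (λ _ → closingᵇ))

    same-arc-shift : ∀ {k′ e t} → k′ + e ≡ k → SameArc k′ t (t + e)
    same-arc-shift {k′} {e} {t} k′+e≡k =
      (λ t<k′ → subst (t + e <_) k′+e≡k (+-monoˡ-< e t<k′)) ,
      (λ k′≤t → subst (_≤ t + e) k′+e≡k (+-monoˡ-≤ e k′≤t))

    repeat-in-first-arc : ∀ i d → 0 < d → i + d ≤ k → w i ≡ w (i + d) → Shorter C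
    repeat-in-first-arc i d 0<d i+d≤k wᵢ≡wᵢ₊d with d <? k
    ... | no d≮k = ⊥-elim (w₀≢wₖ (begin
      w 0        ≡⟨ cong w i≡0 ⟨
      w i        ≡⟨ wᵢ≡wᵢ₊d ⟩
      w (i + d)  ≡⟨ cong w (cong₂ _+_ i≡0 d≡k) ⟩
      w k        ∎))
      where
      open ≡-Reasoning
      d≡k : d ≡ k
      d≡k = ≤-antisym (≤-trans (m≤n+m d i) i+d≤k) (≮⇒≥ d≮k)
      i≡0 : i ≡ 0
      i≡0 = n≤0⇒n≡0 (+-cancelʳ-≤ d i 0 (≤-trans i+d≤k (≤-reflexive (sym d≡k))))
    ... | yes d<k = shortcut i d k′ 0<d (≤-<-trans i+d≤k k<L)
      (subst (λ u → FittingEdge k′ i u (w (suc (i + d)))) (sym wᵢ≡wᵢ₊d)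
        (old-edge (same-arc-shift k′+d≡k) (≤-<-trans i+d≤k k<L)))
      (λ t t<i → (λ t<k′ → <-≤-trans t<k′ (m∸n≤m k d)) ,
                 (λ k′≤t → ⊥-elim (<⇒≱ t<i (≤-trans i≤k′ k′≤t))))
      (λ _ _ _ → same-arc-shift k′+d≡k)
      (m<n⇒0<n∸m d<k) (∸-monoˡ-< k<L (<⇒≤ d<k))
      (λ k′≤i w₀≡wₖ′ → w₀≢wₖ (trans w₀≡wₖ′ (trans (cong w (≤-antisym k′≤i i≤k′))
                          (trans wᵢ≡wᵢ₊d (cong w (trans (cong (_+ d) (≤-antisym i≤k′ k′≤i))
                                                          k′+d≡k))))))
      (λ _ w₀≡wₖ → w₀≢wₖ (trans w₀≡wₖ (cong w k′+d≡k)))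
      where
      k′ = k ∸ d
      k′+d≡k : k′ + d ≡ k
      k′+d≡k = m∸n+n≡m (<⇒≤ d<k)
      i≤k′ : i ≤ k′
      i≤k′ = subst (_≤ k′) (m+n∸n≡m i d) (∸-monoˡ-≤ d i+d≤k)

    repeat-across : ∀ i d → 0 < i → i < k → k < i + d → i + d < L → w i ≡ w (i + d) →
                    w 0 ≢ w i → Shorter C
    repeat-across i d 0<i i<k k<i+d i+d<L wᵢ≡wᵢ₊d w₀≢wᵢ = shortcut i d i 0<d i+d<L
      (subst (λ u → FittingEdge i i u (w (suc (i + d)))) (sym wᵢ≡wᵢ₊d)
        (old-edge ((λ i<i → ⊥-elim (<-irrefl refl i<i)) , (λ _ → <⇒≤ k<i+d)) i+d<L))
      (λ t t<i → (λ _ → <-trans t<i i<k) , (λ i≤t → ⊥-elim (<⇒≱ t<i i≤t)))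
      (λ t i<t _ → (λ t<i → ⊥-elim (<-asym i<t t<i)) ,
                   (λ i≤t → ≤-trans (<⇒≤ k<i+d) (+-monoˡ-≤ d i≤t)))
      0<i (subst (_< L ∸ d) (m+n∸n≡m i d) (∸-monoˡ-< i+d<L (m≤n+m d i)))
      (λ _ → w₀≢wᵢ) (λ i<i → ⊥-elim (<-irrefl refl i<i))
      where
      0<d : 0 < d
      0<d = subst (0 <_) (m+n∸m≡n i d) (<-≤-trans (m<n⇒0<n∸m i<k) (∸-monoˡ-≤ i (<⇒≤ k<i+d)))

    chord-in-first-arc : ∀ i d → 2 ≤ d → i + d ≤ k → Edge G (w i) (w (i + d)) →
                         0 < i ⊎ suc d < L → Shorter C
    chord-in-first-arc i (suc e) (s≤s 0<e) i+d≤k chord room with col δ (w i) (w (i + suc e)) ≟C a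
    ... | yes chordᵃ = shortcut i e k′ 0<e (<-≤-trans i+e<i+d (≤-trans i+d≤k (<⇒≤ k<L)))
      (subst (λ j → FittingEdge k′ i (w i) (w j)) (+-suc i e)
        (chord , (λ _ → chordᵃ) , (λ k′≤i → ⊥-elim (<⇒≱ i<k′ k′≤i))))
      (λ t t<i → (λ t<k′ → <-≤-trans t<k′ (m∸n≤m k e)) ,
                 (λ k′≤t → ⊥-elim (<-asym t<i (<-≤-trans i<k′ k′≤t))))
      (λ _ _ _ → same-arc-shift k′+e≡k)
      (≤-<-trans z≤n i<k′) (∸-monoˡ-< k<L e≤k)
      (λ k′≤i → ⊥-elim (<⇒≱ i<k′ k′≤i))
      (λ _ w₀≡wₖ → w₀≢wₖ (trans w₀≡wₖ (cong w k′+e≡k)))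
      where
      k′ = k ∸ e
      i+e<i+d : i + e < i + suc e
      i+e<i+d = +-monoʳ-< i (n<1+n e)
      e≤k : e ≤ k
      e≤k = ≤-trans (m≤n+m e i) (≤-trans (<⇒≤ i+e<i+d) i+d≤k)
      k′+e≡k : k′ + e ≡ k
      k′+e≡k = m∸n+n≡m e≤k
      i<k′ : i < k′
      i<k′ = subst (_≤ k′) (m+n∸n≡m (suc i) e) (∸-monoˡ-≤ e (subst (_≤ k) (+-suc i e) i+d≤k))
    ... | no chord≢a = window i (suc e) (suc e) (≤-trans i+d≤k (<⇒≤ k<L)) (short room)
      (edge-sym chord) (trans (col-sym δ _ _) (≢∧≢⇒≡ a≢b chord≢a))
      (λ t t<d → (λ _ → <-≤-trans (+-monoʳ-< i t<d) i+d≤k) ,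
                 (λ d≤t → ⊥-elim (<⇒≱ t<d d≤t)))
      z<s ≤-refl (edge-irrefl chord)
      where
      short : 0 < i ⊎ suc (suc e) < L → suc (suc e) < L
      short (inj₁ 0<i) = <-≤-trans (s≤s (+-monoˡ-≤ (suc e) 0<i)) (≤-<-trans i+d≤k k<L)
      short (inj₂ d<L) = d<L

    crossing-chord : ∀ i d → i < k → k < i + d → i + d < L → Edge G (w i) (w (i + d)) →
                     col δ (w i) (w (i + d)) ≡ a → w 0 ≢ w (i + d) → Shorter C
    crossing-chord i zero    i<k k<i+d _ _ _ _ = ⊥-elim (<-asym i<k (subst (k <_) (+-identityʳ i) k<i+d))
    crossing-chord i (suc e) i<k k<i+d i+d<L chord chordᵃ w₀≢wⱼ = shortcut i e (suc i) 0<e i+e<L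
      (subst (λ j → FittingEdge (suc i) i (w i) (w j)) (+-suc i e)
        (chord , (λ _ → chordᵃ) , (λ i<i → ⊥-elim (<-irrefl refl i<i))))
      (λ t t<i → (λ _ → <-trans t<i i<k) , (λ i<t → ⊥-elim (<-asym t<i i<t)))
      (λ t i<t _ → (λ t≤i → ⊥-elim (<⇒≱ i<t (≤-pred t≤i))) ,
                   (λ _ → ≤-trans k≤i+e (+-monoˡ-≤ e (<⇒≤ i<t))))
      z<s (subst (_< L ∸ e) (m+n∸n≡m (suc i) e)
            (∸-monoˡ-< (subst (_< L) (+-suc i e) i+d<L) (m≤n+m e (suc i))))
      (λ i<i → ⊥-elim (<-irrefl refl i<i))
      (λ _ w₀≡wⱼ → w₀≢wⱼ (trans w₀≡wⱼ (cong w (sym (+-suc i e)))))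
      where
      k≤i+e : k ≤ i + e
      k≤i+e = ≤-pred (subst (k <_) (+-suc i e) k<i+d)
      0<e : 0 < e
      0<e = subst (0 <_) (m+n∸m≡n i e) (<-≤-trans (m<n⇒0<n∸m i<k) (∸-monoˡ-≤ i k≤i+e))
      i+e<L : i + e < L
      i+e<L = <-trans (+-monoʳ-< i (n<1+n e)) i+d<L

    chord-from-start : ∀ d → k < d → suc d < L → Edge G (w 0) (w d) → col δ (w 0) (w d) ≡ b →
                       Shorter C
    chord-from-start d k<d d<L chord chordᵇ = window 0 d k (<⇒≤ (<-trans (n<1+n d) d<L)) d<L
      (edge-sym chord) (trans (col-sym δ _ _) chordᵇ) (λ _ _ → (λ t<k → t<k) , (λ k≤t → k≤t))
      0<k (<⇒≤ k<d) w₀≢wₖ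

  circuit-length≥3 : ∀ C → 3 ≤ TwoArcCircuit.L C
  circuit-length≥3 C with 3 ≤? L
    where open TwoArcCircuit C
  ... | yes 3≤L = 3≤L
  ... | no 3≰L = ⊥-elim (a≢b (begin
    a                        ≡⟨ first-arc 0 0<k ⟨
    col δ (w 0) (w 1)        ≡⟨ cong (λ j → col δ (w 0) (w j)) k≡1 ⟨
    col δ (w 0) (w k)        ≡⟨ col-sym δ _ _ ⟩
    col δ (w k) (w 0)        ≡⟨ cong (col δ (w k)) (trans closed (cong w L≡1+k)) ⟩
    col δ (w k) (w (suc k))  ≡⟨ second-arc k ≤-refl k<L ⟩
    b                        ∎))
    where
    open TwoArcCircuit C
    open ≡-Reasoning
    L≡2 : L ≡ 2
    L≡2 = ≤-antisym (≤-pred (≰⇒> 3≰L)) (<-≤-trans (s≤s 0<k) k<L)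
    k≡1 : k ≡ 1
    k≡1 = ≤-antisym (≤-pred (subst (k <_) L≡2 k<L)) 0<k
    L≡1+k : L ≡ suc k
    L≡1+k = trans L≡2 (cong suc (sym k≡1))

  RepeatFree : TwoArcCircuit → Set
  RepeatFree C = ∀ {i j} → i < j → j < L → w i ≢ w j
    where open TwoArcCircuit C

  Chordless : TwoArcCircuit → Set
  Chordless C = ∀ {i j} → i < j → j < L → Edge G (w i) (w j) → j ≡ suc i ⊎ (i ≡ 0 × suc j ≡ L)
    where open TwoArcCircuit C

  simple-circuit⇒cycle : ∀ C → RepeatFree C → Chordless C →
                         Σ (Cycle G) λ Z → Induced Z × ¬ Monochromatic δ Z × colorChanges δ Z ≤ 2
  simple-circuit⇒cycle C repeat-free chordless = cycle , induced , nonmono , changes≤2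
    where
    open TwoArcCircuit C
    m = proj₁ (m≤n⇒∃[o]m+o≡n (circuit-length≥3 C))
    3+m≡L : 3 + m ≡ L
    3+m≡L = proj₂ (m≤n⇒∃[o]m+o≡n (circuit-length≥3 C))
    M = 2 + m

    toℕ<L : ∀ (i : Fin (3 + m)) → toℕ i < L
    toℕ<L i = subst (toℕ i <_) 3+m≡L (toℕ<n i)

    w-next : ∀ (i : Fin (3 + m)) → w (toℕ (next i)) ≡ w (suc (toℕ i))
    w-next i with toℕ-next i
    ... | inj₁ (_ , next≡) = cong w next≡
    ... | inj₂ (i≡M , next≡0) = begin
      w (toℕ (next i))  ≡⟨ cong (w ∘ toℕ) next≡0 ⟩
      w 0               ≡⟨ closed ⟩
      w L               ≡⟨ cong w (trans (sym 3+m≡L) (cong suc (sym i≡M))) ⟩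
      w (suc (toℕ i))   ∎
      where open ≡-Reasoning

    cycle : Cycle G
    cycle = record
      { n = m ; vert = w ∘ toℕ ; inj = injective
      ; edges = λ i → subst (Edge G (w (toℕ i))) (sym (w-next i)) (edge (toℕ i) (toℕ<L i)) }
      where
      injective : Injective _≡_ _≡_ (w ∘ toℕ)
      injective {i} {j} wᵢ≡wⱼ with <-cmp (toℕ i) (toℕ j)
      ... | tri< i<j _ _ = ⊥-elim (repeat-free i<j (toℕ<L j) wᵢ≡wⱼ)
      ... | tri≈ _ i≡j _ = toℕ-injective i≡j
      ... | tri> _ _ j<i = ⊥-elim (repeat-free j<i (toℕ<L i) (sym wᵢ≡wⱼ))

    colour : ∀ i → edgeCol δ cycle i ≡ col δ (w (toℕ i)) (w (suc (toℕ i)))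
    colour i = cong (col δ (w (toℕ i))) (w-next i)

    ordered-chord : ∀ (i j : Fin (3 + m)) → toℕ i < toℕ j → Edge G (w (toℕ i)) (w (toℕ j)) →
                    j ≡ next i ⊎ i ≡ next j
    ordered-chord i j i<j chord with chordless i<j (toℕ<L j) chord | toℕ-next i | toℕ-next j
    ... | inj₁ j≡1+i       | inj₁ (_ , next≡) | _ = inj₁ (toℕ-injective (trans j≡1+i (sym next≡)))
    ... | inj₁ j≡1+i       | inj₂ (i≡M , _)   | _ =
      ⊥-elim (<-irrefl refl (<-≤-trans (subst (_< toℕ j) i≡M i<j) (≤-pred (toℕ<n j))))
    ... | inj₂ (i≡0 , 1+j≡L) | _ | inj₂ (_ , next≡0) =
      inj₂ (trans (toℕ-injective i≡0) (sym next≡0))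
    ... | inj₂ (i≡0 , 1+j≡L) | _ | inj₁ (j<M , _) =
      ⊥-elim (<-irrefl (suc-injective (trans 1+j≡L (sym 3+m≡L))) j<M)

    induced : Induced cycle
    induced i j chord with <-cmp (toℕ i) (toℕ j)
    ... | tri< i<j _ _ = ordered-chord i j i<j chord
    ... | tri≈ _ i≡j _ = ⊥-elim (edge-irrefl chord (cong w i≡j))
    ... | tri> _ _ j<i = Data.Sum.swap (ordered-chord j i j<i (edge-sym chord))

    nonmono : ¬ Monochromatic δ cycle
    nonmono (c , mono) = a≢b (begin
      a                                    ≡⟨ first-arc 0 0<k ⟨
      col δ (w 0) (w 1)                    ≡⟨ colour zero ⟨
      edgeCol δ cycle zero                 ≡⟨ mono zero ⟩
      c                                    ≡⟨ mono kᶠ ⟨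
      edgeCol δ cycle kᶠ                   ≡⟨ colour kᶠ ⟩
      col δ (w (toℕ kᶠ)) (w (suc (toℕ kᶠ))) ≡⟨ cong (λ t → col δ (w t) (w (suc t))) (toℕ-fromℕ< _) ⟩
      col δ (w k) (w (suc k))              ≡⟨ second-arc k ≤-refl k<L ⟩
      b                                    ∎)
      where
      open ≡-Reasoning
      kᶠ = fromℕ< (subst (k <_) (sym 3+m≡L) k<L)

    changes : Fin (3 + m) → Bool
    changes i = not (isCol (edgeCol δ cycle i) (edgeCol δ cycle (next i)))

    counted⇒≢ : ∀ i → changes i ≡ true → edgeCol δ cycle i ≢ edgeCol δ cycle (next i)
    counted⇒≢ i counted same with trans (sym counted) (cong not (isCol-≡ same))
    ... | ()

    last-of-first-arc = fromℕ< (≤-<-trans pred[n]≤n (subst (k <_) (sym 3+m≡L) k<L))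

    changes-at-split-or-end : ∀ i → changes i ≡ true → i ≡ last-of-first-arc ⊎ i ≡ fromℕ M
    changes-at-split-or-end i counted with toℕ-next i
    ... | inj₂ (i≡M , _) = inj₂ (toℕ-injective (trans i≡M (sym (Fin.toℕ-fromℕ M))))
    ... | inj₁ (i<M , next≡) with <-cmp (suc (toℕ i)) k
    ...   | tri≈ _ 1+i≡k _ = inj₁ (toℕ-injective (trans (cong pred 1+i≡k) (sym (toℕ-fromℕ< _))))
    ...   | tri< 1+i<k _ _ = ⊥-elim (counted⇒≢ i counted (begin
      edgeCol δ cycle i                        ≡⟨ colour i ⟩
      col δ (w (toℕ i)) (w (suc (toℕ i)))      ≡⟨ first-arc _ (<-trans (n<1+n _) 1+i<k) ⟩
      a                                        ≡⟨ first-arc _ 1+i<k ⟨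
      col δ (w (suc (toℕ i))) (w (suc (suc (toℕ i)))) ≡⟨ cong (λ t → col δ (w t) (w (suc t))) next≡ ⟨
      col δ (w (toℕ (next i))) (w (suc (toℕ (next i)))) ≡⟨ colour (next i) ⟨
      edgeCol δ cycle (next i)                 ∎))
      where open ≡-Reasoning
    ...   | tri> _ _ k<1+i = ⊥-elim (counted⇒≢ i counted (begin
      edgeCol δ cycle i                        ≡⟨ colour i ⟩
      col δ (w (toℕ i)) (w (suc (toℕ i)))      ≡⟨ second-arc _ (≤-pred k<1+i) (<-trans (n<1+n _) 2+i<L) ⟩
      b                                        ≡⟨ second-arc _ (<⇒≤ k<1+i) 2+i<L ⟨
      col δ (w (suc (toℕ i))) (w (suc (suc (toℕ i)))) ≡⟨ cong (λ t → col δ (w t) (w (suc t))) next≡ ⟨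
      col δ (w (toℕ (next i))) (w (suc (toℕ (next i)))) ≡⟨ colour (next i) ⟨
      edgeCol δ cycle (next i)                 ∎))
      where
      open ≡-Reasoning
      2+i<L : suc (toℕ i) < L
      2+i<L = subst (suc (toℕ i) <_) 3+m≡L (s≤s i<M)

    changes≤2 : colorChanges δ cycle ≤ 2
    changes≤2 = count≤2 last-of-first-arc (fromℕ M) changes changes-at-split-or-end

  module Shortening (C : TwoArcCircuit) where
    open TwoArcCircuit C
    open Surgery C
    private module R = Surgery (reversed C)

    L∸j+d≡L∸i : ∀ i d → i + d ≤ L → L ∸ (i + d) + d ≡ L ∸ i
    L∸j+d≡L∸i i d i+d≤L = begin
      L ∸ (i + d) + d  ≡⟨ cong (_+ d) (∸-+-assoc L i d) ⟨
      L ∸ i ∸ d + d    ≡⟨ m∸n+n≡m (m+n≤o⇒m≤o∸n d (subst (_≤ L) (+-comm i d) i+d≤L)) ⟩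
      L ∸ i            ∎
      where open ≡-Reasoning

    mirrored : ∀ {t} → t ≤ L → w (L ∸ (L ∸ t)) ≡ w t
    mirrored t≤L = cong w (m∸[m∸n]≡n t≤L)

    mirrored-end : ∀ i d → i + d ≤ L → w (L ∸ (L ∸ (i + d) + d)) ≡ w i
    mirrored-end i d i+d≤L =
      trans (cong (λ t → w (L ∸ t)) (L∸j+d≡L∸i i d i+d≤L))
            (mirrored (≤-trans (m≤m+n i _) i+d≤L))

    repeat⇒shorter : ∀ {i j} → i < j → j < L → w i ≡ w j → Shorter C
    repeat⇒shorter {i} i<j j<L wᵢ≡wⱼ with m≤n⇒∃[o]m+o≡n (<⇒≤ i<j)
    ... | zero , refl = ⊥-elim (<-irrefl (sym (+-identityʳ i)) i<j)
    ... | d@(suc _) , refl with i + d ≤? k | k ≤? i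
    ...   | yes j≤k | _       = repeat-in-first-arc i d z<s j≤k wᵢ≡wⱼ
    ...   | no _    | yes k≤i = R.repeat-in-first-arc (L ∸ (i + d)) d z<s
      (subst (_≤ L ∸ k) (sym (L∸j+d≡L∸i i d j≤L)) (∸-monoʳ-≤ L k≤i))
      (trans (mirrored j≤L) (trans (sym wᵢ≡wⱼ) (sym (mirrored-end i d j≤L))))
      where j≤L = <⇒≤ j<L
    ...   | no j≰k  | no k≰i  with i ≟ 0
    ...     | yes refl =
      R.repeat-in-first-arc 0 (L ∸ d) (m<n⇒0<n∸m j<L) (∸-monoʳ-≤ L (<⇒≤ (≰⇒> j≰k)))
      (trans (sym closed) (trans wᵢ≡wⱼ (sym (mirrored (<⇒≤ j<L)))))
    ...     | no i≢0 with w 0 ≟V w i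
    ...       | yes w₀≡wᵢ = repeat-in-first-arc 0 i (n≢0⇒n>0 i≢0) (<⇒≤ (≰⇒> k≰i)) w₀≡wᵢ
    ...       | no w₀≢wᵢ  =
      repeat-across i d (n≢0⇒n>0 i≢0) (≰⇒> k≰i) (≰⇒> j≰k) j<L wᵢ≡wⱼ w₀≢wᵢ

    chord⇒shorter : RepeatFree C → ∀ {i j} → suc i < j → j < L → 0 < i ⊎ suc j < L →
                    Edge G (w i) (w j) → Shorter C
    chord⇒shorter repeat-free {i} 1+i<j j<L room chord
      with m≤n⇒∃[o]m+o≡n (<⇒≤ (<-trans (n<1+n i) 1+i<j))
    ... | d , refl with i + d ≤? k | k ≤? i
    ...   | yes j≤k | _       =
      chord-in-first-arc i d 2≤d j≤k chord (Data.Sum.map₂ (≤-<-trans (s≤s (m≤n+m d i))) room)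
      where 2≤d = 2+m≤m+n⇒2≤n i d 1+i<j
    ...   | no _    | yes k≤i = R.chord-in-first-arc (L ∸ (i + d)) d 2≤d
      (subst (_≤ L ∸ k) (sym (L∸j+d≡L∸i i d (<⇒≤ j<L))) (∸-monoʳ-≤ L k≤i))
      (subst₂ (Edge G) (sym (mirrored (<⇒≤ j<L))) (sym (mirrored-end i d (<⇒≤ j<L))) (edge-sym chord))
      (inj₁ (m<n⇒0<n∸m j<L))
      where 2≤d = 2+m≤m+n⇒2≤n i d 1+i<j
    ...   | no j≰k  | no k≰i with col δ (w i) (w (i + d)) ≟C a
    ...     | yes chordᵃ = crossing-chord i d (≰⇒> k≰i) (≰⇒> j≰k) j<L chord chordᵃ
                             (repeat-free (≤-<-trans z≤n 1+i<j) j<L)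
    ...     | no chord≢a with i ≟ 0
    ...       | yes refl =
      chord-from-start d (≰⇒> j≰k) (on-second-arc room) chord (≢∧≢⇒≡ a≢b chord≢a)
      where
      on-second-arc : 0 < 0 ⊎ suc d < L → suc d < L
      on-second-arc (inj₂ 1+j<L) = 1+j<L
    ...       | no i≢0 = R.crossing-chord (L ∸ (i + d)) d
        (∸-monoʳ-< (≰⇒> j≰k) j≤L)
        (subst (L ∸ k <_) (sym (L∸j+d≡L∸i i d j≤L)) (∸-monoʳ-< (≰⇒> k≰i) (<⇒≤ k<L)))
        (subst (_< L) (sym (L∸j+d≡L∸i i d j≤L)) (∸-monoʳ-< (n≢0⇒n>0 i≢0) (<⇒≤ i<L)))
        (subst₂ (Edge G) (sym (mirrored j≤L)) (sym (mirrored-end i d j≤L)) (edge-sym chord))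
        (trans (cong₂ (col δ) (mirrored j≤L) (mirrored-end i d j≤L))
          (trans (col-sym δ _ _) (≢∧≢⇒≡ a≢b chord≢a)))
        (λ eq → repeat-free (n≢0⇒n>0 i≢0) i<L (trans closed (trans eq (mirrored-end i d j≤L))))
      where
      j≤L = <⇒≤ j<L
      i<L : i < L
      i<L = <-trans (<-trans (n<1+n i) 1+i<j) j<L

  ThreeChanges : Set
  ThreeChanges = ∀ (C : Cycle G) → Induced C → ¬ Monochromatic δ C → 3 ≤ colorChanges δ C

  Repeat : TwoArcCircuit → Set
  Repeat C = ∃ λ j → j < L × ∃ λ i → i < j × w i ≡ w j
    where open TwoArcCircuit C

  repeat? : ∀ C → Dec (Repeat C)
  repeat? C = anyUpTo? (λ j → anyUpTo? (λ i → w i ≟V w j) j) L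
    where open TwoArcCircuit C

  -- A chord that does not join w 0 and w (L - 1), which are adjacent through w L = w 0.
  Chord : TwoArcCircuit → Set
  Chord C = ∃ λ j → j < L × ∃ λ i → i < j × suc i < j × (0 < i ⊎ suc j < L) × Edge G (w i) (w j)
    where open TwoArcCircuit C

  chord? : ∀ C → Dec (Chord C)
  chord? C = anyUpTo? (λ j → anyUpTo? (λ i →
    (suc i <? j) ×-dec ((0 <? i) ⊎-dec (suc j <? L)) ×-dec (adj G (w i) (w j) Bool.≟ true)) j) L
    where open TwoArcCircuit C

  ¬repeat⇒repeatFree : ∀ C → ¬ Repeat C → RepeatFree C
  ¬repeat⇒repeatFree C no-repeat {i} {j} i<j j<L wᵢ≡wⱼ = no-repeat (j , j<L , i , i<j , wᵢ≡wⱼ)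

  ¬chord⇒chordless : ∀ C → ¬ Chord C → Chordless C
  ¬chord⇒chordless C no-chord {i} {j} i<j j<L chord with j ≟ suc i | i ≟ 0 | suc j ≟ L
    where open TwoArcCircuit C
  ... | yes j≡1+i | _       | _         = inj₁ j≡1+i
  ... | no _      | yes i≡0 | yes 1+j≡L = inj₂ (i≡0 , 1+j≡L)
  ... | no j≢1+i  | no i≢0  | _         =
    ⊥-elim (no-chord (j , j<L , i , i<j , ≤∧≢⇒< i<j (j≢1+i ∘ sym) , inj₁ (n≢0⇒n>0 i≢0) , chord))
  ... | no j≢1+i  | yes _   | no 1+j≢L  =
    ⊥-elim (no-chord (j , j<L , i , i<j , ≤∧≢⇒< i<j (j≢1+i ∘ sym) , inj₂ (≤∧≢⇒< j<L 1+j≢L) , chord))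

  InducedThreeChanges : Set
  InducedThreeChanges = ∀ (Z : Cycle G) → Induced Z → ¬ Monochromatic δ Z → 3 ≤ colorChanges δ Z

  shorten : InducedThreeChanges → (C : TwoArcCircuit) → Shorter C
  shorten three C with repeat? C | chord? C
  ... | yes (j , j<L , i , i<j , wᵢ≡wⱼ) | _ = repeat⇒shorter i<j j<L wᵢ≡wⱼ
    where open Shortening C
  ... | no no-repeat | yes (j , j<L , i , _ , 1+i<j , room , chord) =
    chord⇒shorter (¬repeat⇒repeatFree C no-repeat) 1+i<j j<L room chord
    where open Shortening C
  ... | no no-repeat | no no-chord
    with simple-circuit⇒cycle C (¬repeat⇒repeatFree C no-repeat) (¬chord⇒chordless C no-chord)
  ...   | Z , induced , nonmono , changes≤2 =
    ⊥-elim (1+n≰n (≤-trans (three Z induced nonmono) changes≤2))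

  inducedThreeChanges⇒noCircuit : InducedThreeChanges → ¬ TwoArcCircuit
  inducedThreeChanges⇒noCircuit three =
    All.wfRec (On.wellFounded TwoArcCircuit.L <-wellFounded) 0ℓ (λ _ → ⊥) shrink
    where
    shrink : ∀ C → (∀ {C′} → TwoArcCircuit.L C′ < TwoArcCircuit.L C → ⊥) → ⊥
    shrink C no-shorter with shorten three C
    ... | C′ , C′<C = no-shorter {C′} C′<C

lemma1p12 : (G : Graph) → Connected G → (δ : Coloring G) → Surjective G δ →
    (IsCartesianNAC G δ ⇔
      (∀ (C : Cycle G) → Induced C → ¬ Monochromatic δ C → 3 ≤ colorChanges δ C))
lemma1p12 G _ δ surjective = mk⇔
  (λ (_ , cartesian) C _ → noCircuit⇒colorChanges≥3 (cartesian⇒noCircuit cartesian) C)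
  (λ three → let noCircuit = inducedThreeChanges⇒noCircuit three in
    (surjective , noCircuit⇒NAC-cycle noCircuit) ,
    (λ u v u≢v (red-walk , blue-walk) → noCircuit (walks⇒circuit u≢v red-walk blue-walk)))
  where open Colouring G δ
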